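{- There is an absolute constant $c>0$ such that for every $\sigma\in\{132,213,231,312\}$ and all positive integers $n,k$ there is an input sequence $X\in[0,1]^n$ that avoids $\sigma$ and satisfies $\mathrm{OPT}_k(X)\ge c\cdot 4^{ -k}\cdot n^{1/k}$.
   Context: Two real sequences $(x_1,\dots,x_m)$ and $(y_1,\dots,y_m)$ are order-isomorphic if $x_i<x_j \iff y_i<y_j$ for all $i,j$. A sequence $X$ contains a sequence $Y$ if some (not necessarily contiguous) subsequence of $X$ is order-isomorphic to $Y$; otherwise $X$ avoids $Y$. $k$-server on the line: for requests $X\in[0,1]^n$ and $k$ servers, let $p_i^j\in[0,1]$ be the position of server $j$ after request $i$, with $p_0^j=0$. A solution is valid if for every $i$ some $p_i^j=x_i$; its cost is $\sum_{i}\sum_{j}|p_i^j-p_{i-1}^j|$; $\mathrm{OPT}_k(X)$ is the minimum cost.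
   Formalization: The server positions $p_i^j$ are rational, and the input sequence $X$ and the constant $c$ are taken in the rationals. -}

module Defs where

open import Data.Nat as ℕ using (ℕ; zero; suc)
open import Data.Fin as Fin using (Fin; inject₁)
open import Data.Rational using (ℚ; 0ℚ; 1ℚ; _/_; _+_; _*_; _-_; _<_; _≤_; ∣_∣)
open import Data.Integer using (+_)
open import Data.Product using (Σ; ∃; _×_; _,_)
open import Function.Bundles using (_⇔_)
open import Relation.Nullary using (¬_)
open import Relation.Binary.PropositionalEquality using (_≡_)

-- Finite real sequences are modelled by rational sequences.
Seq : ℕ → Set
Seq n = Fin n → ℚ

fromℕ : ℕ → ℚ
fromℕ n = (+ n) / 1

sumFin : ∀ {n} → (Fin n → ℚ) → ℚ
sumFin {zero} f = 0ℚ
sumFin {suc n} f = f Fin.zero + sumFin (λ i → f (Fin.suc i))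

pow : ℚ → ℕ → ℚ
pow q zero = 1ℚ
pow q (suc m) = q * pow q m

OrderIso : ∀ {m} → Seq m → Seq m → Set
OrderIso {m} x y = ∀ (i j : Fin m) → (x i < x j) ⇔ (y i < y j)

Contains : ∀ {n m} → Seq n → Seq m → Set
Contains {n} {m} X Y =
  Σ (Fin m → Fin n) λ f →
    (∀ (i j : Fin m) → i Fin.< j → f i Fin.< f j) × OrderIso (λ i → X (f i)) Y

Avoids : ∀ {n m} → Seq n → Seq m → Set
Avoids X Y = ¬ Contains X Y

pow4 : ℕ → ℕ
pow4 k = 4 ℕ.^ k

data Pattern : Set where
  p132 p213 p231 p312 : Pattern

digits : ℕ → ℕ → ℕ → Seq 3
digits a b c Fin.zero = fromℕ a
digits a b c (Fin.suc Fin.zero) = fromℕ b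
digits a b c (Fin.suc (Fin.suc Fin.zero)) = fromℕ c

pattern→seq : Pattern → Seq 3
pattern→seq p132 = digits 1 3 2
pattern→seq p213 = digits 2 1 3
pattern→seq p231 = digits 2 3 1
pattern→seq p312 = digits 3 1 2

InUnit : ℚ → Set
InUnit x = (0ℚ ≤ x) × (x ≤ 1ℚ)

-- k-server on the line.  A solution for requests X (length n) with k servers:
-- p i j = position of server j after request i (i = 0 .. n), p 0 j = 0.
record Solution (n k : ℕ) (X : Seq n) : Set where
  field
    pos     : Fin (suc n) → Fin k → ℚ
    start   : ∀ (j : Fin k) → pos Fin.zero j ≡ 0ℚ
    inRange : ∀ (i : Fin (suc n)) (j : Fin k) → InUnit (pos i j)
    serves  : ∀ (i : Fin n) → ∃ λ (j : Fin k) → pos (Fin.suc i) j ≡ X i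

cost : ∀ {n k} {X : Seq n} → Solution n k X → ℚ
cost {n} {k} s = sumFin {n} λ i → sumFin {k} λ j →
  ∣ Solution.pos s (Fin.suc i) j - Solution.pos s (inject₁ i) j ∣

{-# OPTIONS --safe #-}
-- Fix m ≥ 1 and W = 2m. On the grid ℕ, the level-0 sequence based at a is the single point a, and the
-- level-(k+1) sequence consists of m phases: phase i requests the top point a + W^(k+1) and then the
-- level-k sequence based at a + i·W^k. The server that serves a top point either later travels down into
-- the slot below it, a distance of at least m·W^k ≥ m^(k+1), or leaves the whole slot to the other k
-- servers. By induction on k, serving the level-k sequence with k servers therefore costs at least
-- m^(k+1), while its length is at most W^k. Visiting the slots in increasing order of i avoids 231, in
-- decreasing order 132. Placing grid point g at g/W^k (or at 1 − g/W^k, which turns these into 213 and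
-- 312) and taking the largest m with W^k ≤ n gives 4^k·OPT_k ≥ 2^k·m ≥ (n/2^k)^(1/k). When n < 2^k, a
-- constant sequence of 1s already costs 1.
module Submission where

open import Defs
open import Data.Nat as ℕ using (ℕ; zero; suc; _≥_; z≤n; s≤s)
import Data.Nat.Properties as ℕₚ
open import Data.Nat.Tactic.RingSolver using (solve-∀)
open import Algebra.Properties.CommutativeSemigroup ℕₚ.*-commutativeSemigroup
  using () renaming (interchange to ℕ-interchange)
import Data.Integer as ℤ
import Data.Integer.Properties as ℤₚ
open import Data.Rational as ℚ using (ℚ)
import Data.Rational.Properties as ℚₚ
import Data.Rational.Literals as Literals
open import Data.Rational.Solver using (module +-*-Solver)
open +-*-Solver using (solve; _:+_; _:-_; :-_; _:*_; _:=_; con)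
open import Algebra.Bundles using (module Ring)
open import Algebra.Properties.Semiring.Mult (Ring.semiring ℚₚ.+-*-ring)
  using (×-homo-+; ×-assocˡ; ×-assoc-*; ×1-homo-*)
  renaming (_×_ to infixr 8 _·_)
open import Data.Fin as Fin using (Fin; toℕ; punchIn; #_)
import Data.Fin.Properties as Finₚ
open import Data.List using (List; []; _∷_; _++_; length; concatMap; upTo; downFrom)
import Data.List.Properties as Listₚ
open import Data.List.Membership.Propositional using (_∈_)
open import Data.List.Relation.Unary.Any using (here; there)
open import Data.List.Relation.Unary.All as All using (All; []; _∷_)
import Data.List.Relation.Unary.All.Properties as Allₚ
open import Data.List.Relation.Unary.AllPairs using (AllPairs; []; _∷_)
import Data.List.Relation.Unary.AllPairs.Properties as AllPairsₚ
open import Data.Product using (Σ; ∃; ∃-syntax; _×_; _,_; proj₂)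
open import Data.Sum using (_⊎_; inj₁; inj₂)
open import Data.Unit using (⊤; tt)
open import Function using (_∘_; id)
open import Function.Bundles using (Equivalence)
open import Relation.Nullary using (¬_; yes; no; contradiction)
open import Relation.Nullary.Decidable using (from-yes)
open import Relation.Binary.PropositionalEquality

module Avoidance where
  open import Data.Nat using (_<_; _≤_)

  lookupOr : ℕ → List ℕ → ℕ → ℕ
  lookupOr d [] t = d
  lookupOr d (x ∷ xs) zero = x
  lookupOr d (x ∷ xs) (suc t) = lookupOr d xs t

  All-lookupOr : ∀ {P : ℕ → Set} {d} xs → P d → All P xs → ∀ t → P (lookupOr d xs t)
  All-lookupOr [] Pd [] t = Pd
  All-lookupOr (x ∷ xs) Pd (Px ∷ _) zero = Px
  All-lookupOr (x ∷ xs) Pd (_ ∷ Pxs) (suc t) = All-lookupOr xs Pd Pxs t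

  Occurs : (ℕ → ℕ → ℕ → Set) → (ℕ → ℕ) → Set
  Occurs R g = ∃[ p ] ∃[ q ] ∃[ r ] p < q × q < r × R (g p) (g q) (g r)

  Avoiding : (ℕ → ℕ → ℕ → Set) → List ℕ → Set
  Avoiding R [] = ⊤
  Avoiding R (x ∷ xs) = AllPairs (λ y z → ¬ R x y z) xs × Avoiding R xs

  allPairs-bounded : ∀ {S : ℕ → ℕ → Set} {T xs} → All (_≤ T) xs →
    All (λ z → ∀ {y} → y ≤ T → S y z) xs → AllPairs S xs
  allPairs-bounded [] [] = []
  allPairs-bounded (y≤T ∷ xs≤T) (_ ∷ S·z) = All.map (λ S·z → S·z y≤T) S·z ∷ allPairs-bounded xs≤T S·z

  allPairs-lookupOr : ∀ {S : ℕ → ℕ → Set} {T xs} → (∀ {y} → y ≤ T → S y T) → All (_≤ T) xs →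
    AllPairs S xs → ∀ {q r} → q < r → S (lookupOr T xs q) (lookupOr T xs r)
  allPairs-lookupOr S·T [] [] _ = S·T ℕₚ.≤-refl
  allPairs-lookupOr {xs = _ ∷ xs} S·T (y≤T ∷ _) (Sy· ∷ _) {zero} {suc r} _ = All-lookupOr xs (S·T y≤T) Sy· r
  allPairs-lookupOr S·T (_ ∷ xs≤T) (_ ∷ pairs) {suc q} {suc r} (s≤s q<r) = allPairs-lookupOr S·T xs≤T pairs q<r

  module _ {R : ℕ → ℕ → ℕ → Set} where

    avoiding-∷ : ∀ {x xs} → (∀ {x y z} → R x y z → x < y) → All (_≤ x) xs → Avoiding R xs → Avoiding R (x ∷ xs)
    avoiding-∷ first<second xs≤x avoiding =
      allPairs-bounded xs≤x (All.tabulate λ _ y≤x r → ℕₚ.<⇒≱ (first<second r) y≤x) , avoiding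

    avoiding-++ : ∀ {T xs ys} → All (_≤ T) xs → All (_≤ T) ys → Avoiding R xs → Avoiding R ys →
      All (λ z → All (λ x → ∀ {y} → y ≤ T → ¬ R x y z) xs) ys → Avoiding R (xs ++ ys)
    avoiding-++ [] _ _ avoiding-ys _ = avoiding-ys
    avoiding-++ {T} {x ∷ _} {ys} (_ ∷ xs≤T) ys≤T (pairs , avoiding-xs) avoiding-ys separated =
      AllPairsₚ.++⁺ pairs (allPairs-bounded ys≤T heads) (All.map (λ y≤T → All.map (λ h → h y≤T) heads) xs≤T) ,
      avoiding-++ xs≤T ys≤T avoiding-xs avoiding-ys (All.map All.tail separated)
      where
      heads : All (λ z → ∀ {y} → y ≤ T → ¬ R x y z) ys
      heads = All.map All.head separated

    avoiding⇒¬Occurs : ∀ {T xs} → (∀ {x y} → x ≤ T → y ≤ T → ¬ R x y T) → All (_≤ T) xs →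
      Avoiding R xs → ¬ Occurs R (lookupOr T xs)
    avoiding⇒¬Occurs top [] _ (_ , _ , _ , _ , _ , r) = top ℕₚ.≤-refl ℕₚ.≤-refl r
    avoiding⇒¬Occurs top (x≤T ∷ xs≤T) (pairs , _) (zero , suc q , suc r , _ , s≤s q<r , r′) =
      allPairs-lookupOr (top x≤T) xs≤T pairs q<r r′
    avoiding⇒¬Occurs top (_ ∷ xs≤T) (_ , avoiding) (suc p , suc q , suc r , s≤s p<q , s≤s q<r , r′) =
      avoiding⇒¬Occurs top xs≤T avoiding (p , q , r , p<q , q<r , r′)

  Is231 Is132 : ℕ → ℕ → ℕ → Set
  Is231 x y z = z < x × x < y
  Is132 x y z = x < z × z < y

open Avoidance

module Grid (m : ℕ) (offsets : List ℕ) (offsets<m : All (ℕ._< m) offsets) where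
  open import Data.Nat using (_+_; _*_; _^_; _<_; _≤_)

  W : ℕ
  W = 2 * m

  m≤W : m ≤ W
  m≤W = ℕₚ.m≤m+n m (m + 0)

  next-offset : ∀ a i U → a + i * U + U ≡ a + suc i * U
  next-offset = solve-∀

  mutual
    hardSeq : ℕ → ℕ → List ℕ
    hardSeq zero a = a ∷ []
    hardSeq (suc k) a = concatMap (phase k a) offsets

    phase : ℕ → ℕ → ℕ → List ℕ
    phase k a i = a + W ^ suc k ∷ hardSeq k (a + i * W ^ k)

  phases-fit : ∀ {i} U → i < m → suc i * U + m * U ≤ W * U
  phases-fit {i} U i<m = begin
    suc i * U + m * U  ≡⟨ ℕₚ.*-distribʳ-+ U (suc i) m ⟨
    (suc i + m) * U    ≤⟨ ℕₚ.*-monoˡ-≤ U (ℕₚ.+-monoˡ-≤ m i<m) ⟩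
    (m + m) * U        ≡⟨ cong (λ n → (m + n) * U) (ℕₚ.+-identityʳ m) ⟨
    W * U              ∎
    where open ℕₚ.≤-Reasoning

  slot-top≤top : ∀ {a i} U → i < m → a + i * U + U ≤ a + W * U
  slot-top≤top {a} {i} U i<m = begin
    a + i * U + U            ≡⟨ next-offset a i U ⟩
    a + suc i * U            ≤⟨ ℕₚ.+-monoʳ-≤ a (ℕₚ.m≤m+n (suc i * U) (m * U)) ⟩
    a + (suc i * U + m * U)  ≤⟨ ℕₚ.+-monoʳ-≤ a (phases-fit U i<m) ⟩
    a + W * U                ∎
    where open ℕₚ.≤-Reasoning

  slot+gap≤top : ∀ {k a i y} → i < m → y ≤ a + i * W ^ k + W ^ k → y + m ^ suc k ≤ a + W ^ suc k
  slot+gap≤top {k} {a} {i} {y} i<m y≤ = begin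
    y + m * m ^ k                          ≤⟨ ℕₚ.+-mono-≤ y≤ (ℕₚ.*-monoʳ-≤ m (ℕₚ.^-monoˡ-≤ k m≤W)) ⟩
    a + i * W ^ k + W ^ k + m * W ^ k      ≡⟨ cong (_+ m * W ^ k) (next-offset a i (W ^ k)) ⟩
    a + suc i * W ^ k + m * W ^ k          ≡⟨ ℕₚ.+-assoc a (suc i * W ^ k) (m * W ^ k) ⟩
    a + (suc i * W ^ k + m * W ^ k)        ≤⟨ ℕₚ.+-monoʳ-≤ a (phases-fit (W ^ k) i<m) ⟩
    a + W ^ suc k                          ∎
    where open ℕₚ.≤-Reasoning

  slot-top≤offset : ∀ {a i i′} U → i < i′ → a + i * U + U ≤ a + i′ * U
  slot-top≤offset {a} {i} U i<i′ =
    ℕₚ.≤-trans (ℕₚ.≤-reflexive (next-offset a i U)) (ℕₚ.+-monoʳ-≤ a (ℕₚ.*-monoˡ-≤ U i<i′))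

  mutual
    hardSeq-range : ∀ k a → All (λ z → a ≤ z × z ≤ a + W ^ k) (hardSeq k a)
    hardSeq-range zero a = (ℕₚ.≤-refl , ℕₚ.m≤m+n a 1) ∷ []
    hardSeq-range (suc k) a = phases-range k a offsets<m

    phases-range : ∀ k a {is} → All (_< m) is → All (λ z → a ≤ z × z ≤ a + W ^ suc k) (concatMap (phase k a) is)
    phases-range k a is<m = Allₚ.concat⁺ (Allₚ.map⁺ (All.map
      (λ i<m → All.map (λ (slot≤z , z≤top) → ℕₚ.≤-trans (ℕₚ.m≤m+n a _) slot≤z , z≤top) (phase-range k a i<m))
      is<m))

    phase-range : ∀ k a {i} → i < m → All (λ z → a + i * W ^ k ≤ z × z ≤ a + W ^ suc k) (phase k a i)
    phase-range k a {i} i<m =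
      (ℕₚ.≤-trans (ℕₚ.m≤m+n (a + i * W ^ k) (W ^ k)) (slot-top≤top (W ^ k) i<m) , ℕₚ.≤-refl) ∷
      All.map (λ (slot≤z , z≤) → slot≤z , ℕₚ.≤-trans z≤ (slot-top≤top (W ^ k) i<m)) (hardSeq-range k (a + i * W ^ k))

  phase-top⊎low : ∀ k a i → All (λ z → z ≡ a + W ^ suc k ⊎ z ≤ a + i * W ^ k + W ^ k) (phase k a i)
  phase-top⊎low k a i = inj₁ refl ∷ All.map (inj₂ ∘ proj₂) (hardSeq-range k (a + i * W ^ k))

  length-hardSeq : .{{ℕ.NonZero m}} → length offsets ≤ m → ∀ k a → length (hardSeq k a) ≤ W ^ k
  length-hardSeq |offsets|≤m zero a = ℕₚ.≤-refl
  length-hardSeq |offsets|≤m (suc k) a = begin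
    length (concatMap (phase k a) offsets)  ≤⟨ length-phases offsets ⟩
    length offsets * suc (W ^ k)            ≤⟨ ℕₚ.*-monoˡ-≤ (suc (W ^ k)) |offsets|≤m ⟩
    m * suc (W ^ k)                         ≡⟨ ℕₚ.*-suc m (W ^ k) ⟩
    m + m * W ^ k                           ≤⟨ ℕₚ.+-monoˡ-≤ (m * W ^ k) (ℕₚ.m≤m*n m (W ^ k) {{W^k≢0}}) ⟩
    m * W ^ k + m * W ^ k                   ≡⟨ ℕₚ.*-distribʳ-+ (W ^ k) m m ⟨
    (m + m) * W ^ k                         ≡⟨ cong (λ n → (m + n) * W ^ k) (ℕₚ.+-identityʳ m) ⟨
    W ^ suc k                               ∎
    where
    open ℕₚ.≤-Reasoning

    W^k≢0 : ℕ.NonZero (W ^ k)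
    W^k≢0 = ℕₚ.m^n≢0 W k {{ℕₚ.m*n≢0 2 m}}

    length-phases : ∀ is → length (concatMap (phase k a) is) ≤ length is * suc (W ^ k)
    length-phases [] = z≤n
    length-phases (i ∷ is) = begin
      length (phase k a i ++ concatMap (phase k a) is)    ≡⟨ Listₚ.length-++ (phase k a i) ⟩
      length (phase k a i) + length (concatMap (phase k a) is)
        ≤⟨ ℕₚ.+-mono-≤ (s≤s (length-hardSeq |offsets|≤m k _)) (length-phases is) ⟩
      suc (W ^ k) + length is * suc (W ^ k)               ∎

  Separated : (ℕ → ℕ → ℕ → Set) → ℕ → ℕ → ℕ → ℕ → Set
  Separated R k a i i′ =
    All (λ z → All (λ x → ∀ {y} → y ≤ a + W ^ suc k → ¬ R x y z) (hardSeq k (a + i * W ^ k))) (phase k a i′)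

  module _ {R : ℕ → ℕ → ℕ → Set} (first<second : ∀ {x y z} → R x y z → x < y)
           {_≺_ : ℕ → ℕ → Set} (sorted : AllPairs _≺_ offsets)
           (separated : ∀ {k a i i′} → i < m → i′ < m → i ≺ i′ → Separated R k a i i′) where

    hardSeq-avoiding : ∀ k a → Avoiding R (hardSeq k a)
    hardSeq-avoiding zero a = [] , tt
    hardSeq-avoiding (suc k) a = phases-avoiding offsets offsets<m sorted
      where
      phases-avoiding : ∀ is → All (_< m) is → AllPairs _≺_ is → Avoiding R (concatMap (phase k a) is)
      phases-avoiding [] _ _ = tt
      phases-avoiding (i ∷ is) (i<m ∷ is<m) (i≺is ∷ is-sorted) =
        avoiding-∷ first<second (Allₚ.++⁺ block≤top later≤top)
          (avoiding-++ block≤top later≤top (hardSeq-avoiding k _) (phases-avoiding is is<m is-sorted) block∣later)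
        where
        block≤top : All (_≤ a + W ^ suc k) (hardSeq k (a + i * W ^ k))
        block≤top = All.map (λ (_ , z≤) → ℕₚ.≤-trans z≤ (slot-top≤top (W ^ k) i<m)) (hardSeq-range k (a + i * W ^ k))

        later≤top : All (_≤ a + W ^ suc k) (concatMap (phase k a) is)
        later≤top = All.map proj₂ (phases-range k a is<m)

        block∣later : All (λ z → All (λ x → ∀ {y} → y ≤ a + W ^ suc k → ¬ R x y z) (hardSeq k (a + i * W ^ k)))
                          (concatMap (phase k a) is)
        block∣later = Allₚ.concat⁺ (Allₚ.map⁺
          (All.zipWith (λ (i′<m , i≺i′) → separated {k} {a} i<m i′<m i≺i′) (is<m , i≺is)))

  separated231 : ∀ {k a i i′} → i < m → i′ < m → i < i′ → Separated Is231 k a i i′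
  separated231 {k} {a} {i} i<m i′<m i<i′ = All.map
    (λ (slot≤z , _) → All.map
      (λ (_ , x≤) {_} _ (z<x , _) →
        ℕₚ.<⇒≱ z<x (ℕₚ.≤-trans x≤ (ℕₚ.≤-trans (slot-top≤offset (W ^ k) i<i′) slot≤z)))
      (hardSeq-range k (a + i * W ^ k)))
    (phase-range k a i′<m)

  separated132 : ∀ {k a i i′} → i < m → i′ < m → i′ < i → Separated Is132 k a i i′
  separated132 {k} {a} {i} {i′} i<m i′<m i′<i = All.map
    (λ z-top⊎low → All.map (λ (slot≤x , _) {_} → excluded z-top⊎low slot≤x) (hardSeq-range k (a + i * W ^ k)))
    (phase-top⊎low k a i′)
    where
    excluded : ∀ {x y z} → z ≡ a + W ^ suc k ⊎ z ≤ a + i′ * W ^ k + W ^ k → a + i * W ^ k ≤ x →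
               y ≤ a + W ^ suc k → ¬ Is132 x y z
    excluded (inj₁ refl) _ y≤top (_ , top<y) = ℕₚ.<⇒≱ top<y y≤top
    excluded (inj₂ z≤) slot≤x _ (x<z , _) =
      ℕₚ.<⇒≱ x<z (ℕₚ.≤-trans z≤ (ℕₚ.≤-trans (slot-top≤offset (W ^ k) i′<i) slot≤x))

module Arithmetic where
  open import Data.Nat using (_+_; _*_; _^_; _<_; _≤_; _<?_)

  ^-distribʳ-* : ∀ m n k → (m * n) ^ k ≡ m ^ k * n ^ k
  ^-distribʳ-* m n zero = refl
  ^-distribʳ-* m n (suc k) = trans (cong ((m * n) *_) (^-distribʳ-* m n k)) (ℕ-interchange m n (m ^ k) (n ^ k))

  2^kM·[2M]^k≡4^k·M^[1+k] : ∀ M k → 2 ^ k * M * (2 * M) ^ k ≡ pow4 k * M ^ suc k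
  2^kM·[2M]^k≡4^k·M^[1+k] M k = begin
    2 ^ k * M * (2 * M) ^ k      ≡⟨ cong (2 ^ k * M *_) (^-distribʳ-* 2 M k) ⟩
    2 ^ k * M * (2 ^ k * M ^ k)  ≡⟨ ℕ-interchange (2 ^ k) M (2 ^ k) (M ^ k) ⟩
    2 ^ k * 2 ^ k * (M * M ^ k)  ≡⟨ cong (_* M ^ suc k) (^-distribʳ-* 2 2 k) ⟨
    pow4 k * M ^ suc k           ∎
    where open ≡-Reasoning

  bracket : ∀ (f : ℕ → ℕ) {n} B → f 0 ≤ n → n < f B → ∃ λ M → f M ≤ n × n < f (suc M)
  bracket f zero f0≤n n<f0 = contradiction f0≤n (ℕₚ.<⇒≱ n<f0)
  bracket f {n} (suc B) f0≤n n<f[1+B] with n <? f B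
  ... | yes n<fB = bracket f B f0≤n n<fB
  ... | no n≮fB = B , ℕₚ.≮⇒≥ n≮fB , n<f[1+B]

  m≤m*1^k : ∀ m k → m ≤ m * 1 ^ k
  m≤m*1^k m k = ℕₚ.≤-reflexive (sym (trans (cong (m *_) (ℕₚ.^-zeroˡ k)) (ℕₚ.*-identityʳ m)))

  m≤m^[1+k] : ∀ m .{{_ : ℕ.NonZero m}} k → m ≤ m ^ suc k
  m≤m^[1+k] m k = ℕₚ.m≤m*n m (m ^ k) {{ℕₚ.m^n≢0 m k}}

  1+M≤2^[1+k]·M : ∀ M .{{_ : ℕ.NonZero M}} k → suc M ≤ 2 ^ suc k * M
  1+M≤2^[1+k]·M M k = begin
    suc M          ≤⟨ ℕₚ.+-monoˡ-≤ M (ℕₚ.n≢0⇒n>0 (ℕ.≢-nonZero⁻¹ M)) ⟩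
    M + M          ≡⟨ cong (M +_) (ℕₚ.+-identityʳ M) ⟨
    2 * M          ≤⟨ ℕₚ.*-monoˡ-≤ M (m≤m^[1+k] 2 k) ⟩
    2 ^ suc k * M  ∎
    where open ℕₚ.≤-Reasoning

  [2+2M]^[1+k]≤2^[1+k]·[2^[1+k]·M]^[1+k] : ∀ M .{{_ : ℕ.NonZero M}} k →
    (2 * suc M) ^ suc k ≤ 2 ^ suc k * (2 ^ suc k * M) ^ suc k
  [2+2M]^[1+k]≤2^[1+k]·[2^[1+k]·M]^[1+k] M k = begin
    (2 * suc M) ^ suc k                  ≤⟨ ℕₚ.^-monoˡ-≤ (suc k) (ℕₚ.*-monoʳ-≤ 2 (1+M≤2^[1+k]·M M k)) ⟩
    (2 * (2 ^ suc k * M)) ^ suc k        ≡⟨ ^-distribʳ-* 2 (2 ^ suc k * M) (suc k) ⟩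
    2 ^ suc k * (2 ^ suc k * M) ^ suc k  ∎
    where open ℕₚ.≤-Reasoning

open Arithmetic

open import Data.Rational using (0ℚ; 1ℚ; ½; _+_; _*_; _-_; _<_; _≤_; ∣_∣; 1/_)
open ℚₚ

p≤p+q : ∀ {p q} → 0ℚ ≤ q → p ≤ p + q
p≤p+q {p} q≥0 = subst (_≤ p + _) (+-identityʳ p) (+-monoʳ-≤ p q≥0)

p≤q+p : ∀ {p q} → 0ℚ ≤ q → p ≤ q + p
p≤q+p {p} {q} q≥0 = subst (p ≤_) (+-comm p q) (p≤p+q q≥0)

p≤∣p∣ : ∀ p → p ≤ ∣ p ∣
p≤∣p∣ p with ≤-total 0ℚ p
... | inj₁ 0≤p = ≤-reflexive (sym (0≤p⇒∣p∣≡p 0≤p))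
... | inj₂ p≤0 = ≤-trans p≤0 (0≤∣p∣ p)

∣p-q∣≡∣q-p∣ : ∀ p q → ∣ p - q ∣ ≡ ∣ q - p ∣
∣p-q∣≡∣q-p∣ p q = trans (sym (∣-p∣≡∣p∣ (p - q)))
  (cong ∣_∣ (solve 2 (λ p q → :- (p :- q) := q :- p) refl p q))

∣p-r∣≤∣p-q∣+∣q-r∣ : ∀ p q r → ∣ p - r ∣ ≤ ∣ p - q ∣ + ∣ q - r ∣
∣p-r∣≤∣p-q∣+∣q-r∣ p q r = subst (λ x → ∣ x ∣ ≤ ∣ p - q ∣ + ∣ q - r ∣)
  (solve 3 (λ p q r → (p :- q) :+ (q :- r) := p :- r) refl p q r)
  (∣p+q∣≤∣p∣+∣q∣ (p - q) (q - r))

*-mono-≤-nonNeg : ∀ {p q r s} → 0ℚ ≤ p → p ≤ q → 0ℚ ≤ r → r ≤ s → p * r ≤ q * s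
*-mono-≤-nonNeg {q = q} {r} 0≤p p≤q 0≤r r≤s =
  ≤-trans (*-monoʳ-≤-nonNeg r {{ℚ.nonNegative 0≤r}} p≤q)
          (*-monoˡ-≤-nonNeg q {{ℚ.nonNegative (≤-trans 0≤p p≤q)}} r≤s)

fromℕ≡fromℤ : ∀ n → fromℕ n ≡ Literals.fromℤ (ℤ.+ n)
fromℕ≡fromℤ n = ↥p/↧p≡p (Literals.fromℤ (ℤ.+ n))

fromℕ≡·1 : ∀ n → fromℕ n ≡ n · 1ℚ
fromℕ≡·1 zero = refl
fromℕ≡·1 (suc n) = begin
  -- 1ℚ + Literals.fromℤ (ℤ.+ n) unfolds to (1 · 1 + n · 1) / (1 · 1) before normalisation.
  fromℕ (suc n)                ≡⟨ /-cong (cong (ℤ._+_ ℤ.1ℤ) (sym (ℤₚ.*-identityʳ (ℤ.+ n)))) refl ⟩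
  1ℚ + Literals.fromℤ (ℤ.+ n)  ≡⟨ cong (1ℚ +_) (sym (fromℕ≡fromℤ n)) ⟩
  1ℚ + fromℕ n                 ≡⟨ cong (1ℚ +_) (fromℕ≡·1 n) ⟩
  suc n · 1ℚ                   ∎
  where open ≡-Reasoning

fromℕ*p≡·p : ∀ n p → fromℕ n * p ≡ n · p
fromℕ*p≡·p n p = begin
  fromℕ n * p      ≡⟨ cong (_* p) (fromℕ≡·1 n) ⟩
  (n · 1ℚ) * p     ≡⟨ ×-assoc-* n 1ℚ p ⟩
  n · (1ℚ * p)     ≡⟨ cong (n ·_) (*-identityˡ p) ⟩
  n · p            ∎
  where open ≡-Reasoning

fromℕ-* : ∀ m n → fromℕ (m ℕ.* n) ≡ fromℕ m * fromℕ n
fromℕ-* m n = trans (fromℕ≡·1 (m ℕ.* n))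
  (trans (×1-homo-* m n) (sym (cong₂ _*_ (fromℕ≡·1 m) (fromℕ≡·1 n))))

fromℕ-positive : ∀ n .{{_ : ℕ.NonZero n}} → ℚ.Positive (fromℕ n)
fromℕ-positive (suc n) = subst ℚ.Positive (sym (fromℕ≡fromℤ (suc n))) _

·-nonNeg : ∀ {p} → 0ℚ ≤ p → ∀ n → 0ℚ ≤ n · p
·-nonNeg 0≤p zero = ≤-refl
·-nonNeg 0≤p (suc n) = +-mono-≤ 0≤p (·-nonNeg 0≤p n)

·-gap : ∀ {p} → 0ℚ ≤ p → ∀ {u v e} → v ℕ.+ e ℕ.≤ u → e · p ≤ u · p - v · p
·-gap {p} 0≤p {u} {v} {e} v+e≤u = subst (e · p ≤_) u·p-v·p (p≤p+q (·-nonNeg 0≤p r))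
  where
  r = u ℕ.∸ (v ℕ.+ e)
  u·p-v·p : e · p + r · p ≡ u · p - v · p
  u·p-v·p = begin
    e · p + r · p                    ≡⟨ solve 3 (λ a b c → b :+ c := (a :+ (b :+ c)) :- a) refl (v · p) (e · p) (r · p) ⟩
    (v · p + (e · p + r · p)) - v · p ≡⟨ cong (_- v · p) (sym (trans (×-homo-+ p (v ℕ.+ e) r)
                                          (trans (cong (_+ r · p) (×-homo-+ p v e)) (+-assoc (v · p) (e · p) (r · p))))) ⟩
    (v ℕ.+ e ℕ.+ r) · p - v · p      ≡⟨ cong (λ n → n · p - v · p) (ℕₚ.m+[n∸m]≡n v+e≤u) ⟩
    u · p - v · p                    ∎
    where open ≡-Reasoning

·-monoˡ-≤ : ∀ {p} → 0ℚ ≤ p → ∀ {m n} → m ℕ.≤ n → m · p ≤ n · p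
·-monoˡ-≤ {p} 0≤p {m} {n} m≤n = begin
  m · p                  ≤⟨ p≤p+q (·-nonNeg 0≤p (n ℕ.∸ m)) ⟩
  m · p + (n ℕ.∸ m) · p  ≡⟨ ×-homo-+ p m (n ℕ.∸ m) ⟨
  (m ℕ.+ (n ℕ.∸ m)) · p  ≡⟨ cong (_· p) (ℕₚ.m+[n∸m]≡n m≤n) ⟩
  n · p                  ∎
  where open ≤-Reasoning

fromℕ-mono-≤ : ∀ {m n} → m ℕ.≤ n → fromℕ m ≤ fromℕ n
fromℕ-mono-≤ {m} {n} m≤n =
  subst₂ _≤_ (sym (fromℕ≡·1 m)) (sym (fromℕ≡·1 n)) (·-monoˡ-≤ (from-yes (0ℚ ≤? 1ℚ)) m≤n)

fromℕ-nonNeg : ∀ n → 0ℚ ≤ fromℕ n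
fromℕ-nonNeg n = fromℕ-mono-≤ {0} {n} z≤n

pow-nonNeg : ∀ {p} → 0ℚ ≤ p → ∀ k → 0ℚ ≤ pow p k
pow-nonNeg 0≤p zero = from-yes (0ℚ ≤? 1ℚ)
pow-nonNeg 0≤p (suc k) = *-mono-≤-nonNeg ≤-refl 0≤p ≤-refl (pow-nonNeg 0≤p k)

pow-mono-≤ : ∀ {p q} → 0ℚ ≤ p → p ≤ q → ∀ k → pow p k ≤ pow q k
pow-mono-≤ 0≤p p≤q zero = ≤-refl
pow-mono-≤ 0≤p p≤q (suc k) = *-mono-≤-nonNeg 0≤p p≤q (pow-nonNeg 0≤p k) (pow-mono-≤ 0≤p p≤q k)

pow-distrib-* : ∀ p q k → pow (p * q) k ≡ pow p k * pow q k
pow-distrib-* p q zero = refl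
pow-distrib-* p q (suc k) = trans (cong ((p * q) *_) (pow-distrib-* p q k))
  (solve 4 (λ p q a b → (p :* q) :* (a :* b) := (p :* a) :* (q :* b)) refl p q (pow p k) (pow q k))

pow-1 : ∀ k → pow 1ℚ k ≡ 1ℚ
pow-1 zero = refl
pow-1 (suc k) = trans (*-identityˡ (pow 1ℚ k)) (pow-1 k)

pow-fromℕ : ∀ n k → pow (fromℕ n) k ≡ fromℕ (n ℕ.^ k)
pow-fromℕ n zero = refl
pow-fromℕ n (suc k) = trans (cong (fromℕ n *_) (pow-fromℕ n k)) (sym (fromℕ-* n (n ℕ.^ k)))

half-pow-bound : ∀ {n k R B} → n ℕ.≤ 2 ℕ.^ k ℕ.* R ℕ.^ k → fromℕ R ≤ B → pow ½ k * fromℕ n ≤ pow B k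
half-pow-bound {n} {k} {R} {B} n≤2^kR^k R≤B = begin
  pow ½ k * fromℕ n                              ≤⟨ *-monoˡ-≤-nonNeg (pow ½ k) {{½^k≥0}} (fromℕ-mono-≤ n≤2^kR^k) ⟩
  pow ½ k * fromℕ (2 ℕ.^ k ℕ.* R ℕ.^ k)          ≡⟨ cong (pow ½ k *_) fromℕ[2^kR^k] ⟩
  pow ½ k * (pow (fromℕ 2) k * pow (fromℕ R) k)  ≡⟨ *-assoc (pow ½ k) (pow (fromℕ 2) k) (pow (fromℕ R) k) ⟨
  pow ½ k * pow (fromℕ 2) k * pow (fromℕ R) k    ≡⟨ cong (_* pow (fromℕ R) k) ½^k·2^k≡1 ⟩
  1ℚ * pow (fromℕ R) k                           ≡⟨ *-identityˡ (pow (fromℕ R) k) ⟩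
  pow (fromℕ R) k                                ≤⟨ pow-mono-≤ (fromℕ-nonNeg R) R≤B k ⟩
  pow B k                                        ∎
  where
  open ≤-Reasoning

  ½^k≥0 : ℚ.NonNegative (pow ½ k)
  ½^k≥0 = ℚ.nonNegative (pow-nonNeg (from-yes (0ℚ ≤? ½)) k)

  fromℕ[2^kR^k] : fromℕ (2 ℕ.^ k ℕ.* R ℕ.^ k) ≡ pow (fromℕ 2) k * pow (fromℕ R) k
  fromℕ[2^kR^k] = trans (fromℕ-* (2 ℕ.^ k) (R ℕ.^ k)) (sym (cong₂ _*_ (pow-fromℕ 2 k) (pow-fromℕ R k)))

  ½^k·2^k≡1 : pow ½ k * pow (fromℕ 2) k ≡ 1ℚ
  ½^k·2^k≡1 = trans (sym (pow-distrib-* ½ (fromℕ 2) k)) (pow-1 k)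

sumFin-nonNeg : ∀ {k} {f : Fin k → ℚ} → (∀ j → 0ℚ ≤ f j) → 0ℚ ≤ sumFin f
sumFin-nonNeg {zero} f≥0 = ≤-refl
sumFin-nonNeg {suc k} f≥0 = +-mono-≤ (f≥0 Fin.zero) (sumFin-nonNeg (f≥0 ∘ Fin.suc))

term≤sumFin : ∀ {k} {f : Fin k → ℚ} → (∀ j → 0ℚ ≤ f j) → ∀ j → f j ≤ sumFin f
term≤sumFin f≥0 Fin.zero = p≤p+q (sumFin-nonNeg (f≥0 ∘ Fin.suc))
term≤sumFin f≥0 (Fin.suc j) = ≤-trans (term≤sumFin (f≥0 ∘ Fin.suc) j) (p≤q+p (f≥0 Fin.zero))

sumFin-punchIn≤ : ∀ {k} {f : Fin (suc k) → ℚ} → (∀ j → 0ℚ ≤ f j) → ∀ j → sumFin (f ∘ punchIn j) ≤ sumFin f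
sumFin-punchIn≤ f≥0 Fin.zero = p≤q+p (f≥0 Fin.zero)
sumFin-punchIn≤ {suc k} {f} f≥0 (Fin.suc j) = +-monoʳ-≤ (f Fin.zero) (sumFin-punchIn≤ (f≥0 ∘ Fin.suc) j)

sumFin-cong : ∀ {k} {f g : Fin k → ℚ} → (∀ i → f i ≡ g i) → sumFin f ≡ sumFin g
sumFin-cong {zero} f≗g = refl
sumFin-cong {suc k} f≗g = cong₂ _+_ (f≗g Fin.zero) (sumFin-cong (f≗g ∘ Fin.suc))

-- P t j is the position of server j at time t.
Schedule : ℕ → Set
Schedule k = ℕ → Fin k → ℚ

stepCost : ∀ {k} → Schedule k → ℚ
stepCost P = sumFin λ j → ∣ P 1 j - P 0 j ∣

prefixCost : ∀ {k} → ℕ → Schedule k → ℚ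
prefixCost zero P = 0ℚ
prefixCost (suc L) P = stepCost P + prefixCost L (P ∘ suc)

stepCost-nonNeg : ∀ {k} (P : Schedule k) → 0ℚ ≤ stepCost P
stepCost-nonNeg P = sumFin-nonNeg λ j → 0≤∣p∣ (P 1 j - P 0 j)

prefixCost-nonNeg : ∀ {k} L (P : Schedule k) → 0ℚ ≤ prefixCost L P
prefixCost-nonNeg zero P = ≤-refl
prefixCost-nonNeg (suc L) P = +-mono-≤ (stepCost-nonNeg P) (prefixCost-nonNeg L (P ∘ suc))

prefixCost-+ : ∀ {k} a b (P : Schedule k) → prefixCost (a ℕ.+ b) P ≡ prefixCost a P + prefixCost b (P ∘ (a ℕ.+_))
prefixCost-+ zero b P = sym (+-identityˡ (prefixCost b P))
prefixCost-+ (suc a) b P = trans (cong (stepCost P +_) (prefixCost-+ a b (P ∘ suc)))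
  (sym (+-assoc (stepCost P) (prefixCost a (P ∘ suc)) (prefixCost b (P ∘ (suc a ℕ.+_)))))

prefixCost-mono : ∀ {k} {a b} (P : Schedule k) → a ℕ.≤ b → prefixCost a P ≤ prefixCost b P
prefixCost-mono {a = a} {b} P a≤b = begin
  prefixCost a P                                          ≤⟨ p≤p+q (prefixCost-nonNeg (b ℕ.∸ a) _) ⟩
  prefixCost a P + prefixCost (b ℕ.∸ a) (P ∘ (a ℕ.+_))   ≡⟨ prefixCost-+ a (b ℕ.∸ a) P ⟨
  prefixCost (a ℕ.+ (b ℕ.∸ a)) P                          ≡⟨ cong (λ c → prefixCost c P) (ℕₚ.m+[n∸m]≡n a≤b) ⟩
  prefixCost b P                                          ∎
  where open ≤-Reasoning

prefixCost-tail≤ : ∀ {k} L (P : Schedule k) → prefixCost L (P ∘ suc) ≤ prefixCost (suc L) P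
prefixCost-tail≤ L P = p≤q+p (stepCost-nonNeg P)

prefixCost≡sumFin : ∀ {k} L (P : Schedule k) →
  prefixCost L P ≡ sumFin {L} λ i → sumFin λ j → ∣ P (suc (toℕ i)) j - P (toℕ i) j ∣
prefixCost≡sumFin zero P = refl
prefixCost≡sumFin (suc L) P = cong (stepCost P +_) (prefixCost≡sumFin L (P ∘ suc))

dropServer : ∀ {k} → Fin (suc k) → Schedule (suc k) → Schedule k
dropServer j P t = P t ∘ punchIn j

prefixCost-dropServer : ∀ {k} L j (P : Schedule (suc k)) → prefixCost L (dropServer j P) ≤ prefixCost L P
prefixCost-dropServer zero j P = ≤-refl
prefixCost-dropServer (suc L) j P = +-mono-≤
  (sumFin-punchIn≤ (λ i → 0≤∣p∣ (P 1 i - P 0 i)) j)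
  (prefixCost-dropServer L j (P ∘ suc))

∣P₀-P₁∣≤stepCost : ∀ {k} (P : Schedule k) j → ∣ P 0 j - P 1 j ∣ ≤ stepCost P
∣P₀-P₁∣≤stepCost P j = subst (_≤ stepCost P) (∣p-q∣≡∣q-p∣ (P 1 j) (P 0 j))
  (term≤sumFin (λ i → 0≤∣p∣ (P 1 i - P 0 i)) j)

-- Request x asks for the point ψ x; the i-th request of the list is served at time i + 1.
Serves : ∀ {k} → (ℕ → ℚ) → Schedule k → List ℕ → Set
Serves ψ P [] = ⊤
Serves ψ P (x ∷ xs) = (∃ λ j → P 1 j ≡ ψ x) × Serves ψ (P ∘ suc) xs

Serves-++⁻ : ∀ {k} ψ (P : Schedule k) xs {ys} → Serves ψ P (xs ++ ys) →
  Serves ψ P xs × Serves ψ (P ∘ (length xs ℕ.+_)) ys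
Serves-++⁻ ψ P [] s = tt , s
Serves-++⁻ ψ P (x ∷ xs) (served , s) with Serves-++⁻ ψ (P ∘ suc) xs s
... | sxs , sys = (served , sxs) , sys

travels⊎dropServer-serves : ∀ {k} ψ (P : Schedule (suc k)) j xs → Serves ψ P xs →
  (∃ λ y → y ∈ xs × ∣ P 0 j - ψ y ∣ ≤ prefixCost (length xs) P) ⊎ Serves ψ (dropServer j P) xs
travels⊎dropServer-serves ψ P j [] _ = inj₂ tt
travels⊎dropServer-serves ψ P j (x ∷ xs) ((j′ , P₁j′≡ψx) , s) with j Fin.≟ j′
... | yes refl = inj₁ (x , here refl , (begin
  ∣ P 0 j - ψ x ∣                               ≡⟨ cong (λ p → ∣ P 0 j - p ∣) P₁j′≡ψx ⟨
  ∣ P 0 j - P 1 j ∣                             ≤⟨ ∣P₀-P₁∣≤stepCost P j ⟩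
  stepCost P                                    ≤⟨ p≤p+q (prefixCost-nonNeg (length xs) (P ∘ suc)) ⟩
  stepCost P + prefixCost (length xs) (P ∘ suc) ∎))
  where open ≤-Reasoning
... | no j≢j′ with travels⊎dropServer-serves ψ (P ∘ suc) j xs s
...   | inj₁ (y , y∈xs , travel) = inj₁ (y , there y∈xs , (begin
  ∣ P 0 j - ψ y ∣                               ≤⟨ ∣p-r∣≤∣p-q∣+∣q-r∣ (P 0 j) (P 1 j) (ψ y) ⟩
  ∣ P 0 j - P 1 j ∣ + ∣ P 1 j - ψ y ∣           ≤⟨ +-mono-≤ (∣P₀-P₁∣≤stepCost P j) travel ⟩
  stepCost P + prefixCost (length xs) (P ∘ suc) ∎))
  where open ≤-Reasoning
...   | inj₂ others-serve =
  inj₂ ((Fin.punchOut j≢j′ , trans (cong (P 1) (Finₚ.punchIn-punchOut j≢j′)) P₁j′≡ψx) , others-serve)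

Spread : ℚ → (ℕ → ℚ) → Set
Spread q ψ = ∀ u v e → v ℕ.+ e ℕ.≤ u → e · q ≤ ∣ ψ u - ψ v ∣

module CostBound (m : ℕ) (offsets : List ℕ) (offsets<m : All (ℕ._< m) offsets) (|offsets|≡m : length offsets ≡ m)
                 {q} (q≥0 : 0ℚ ≤ q) (ψ : ℕ → ℚ) (spread : Spread q ψ) where
  open Grid m offsets offsets<m

  hardSeq-cost : ∀ k a (P : Schedule k) → Serves ψ P (hardSeq k a) →
    (m ℕ.^ suc k) · q ≤ prefixCost (length (hardSeq k a)) P
  hardSeq-cost zero a P ((() , _) , _)
  hardSeq-cost (suc k) a P serves =
    subst (λ c → (c ℕ.* m ℕ.^ suc k) · q ≤ prefixCost (length (hardSeq (suc k) a)) P) |offsets|≡m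
      (phases-cost offsets offsets<m P serves)
    where
    phase-cost : ∀ {i} → i ℕ.< m → (P : Schedule (suc k)) → Serves ψ P (phase k a i) →
                 (m ℕ.^ suc k) · q ≤ prefixCost (length (phase k a i)) P
    phase-cost {i} i<m P ((j , P₁j≡top) , serves) = ≤-trans slot-cost (prefixCost-tail≤ (length slot) P)
      where
      slot : List ℕ
      slot = hardSeq k (a ℕ.+ i ℕ.* W ℕ.^ k)

      slot-range : All (λ z → a ℕ.+ i ℕ.* W ℕ.^ k ℕ.≤ z × z ℕ.≤ a ℕ.+ i ℕ.* W ℕ.^ k ℕ.+ W ℕ.^ k) slot
      slot-range = hardSeq-range k (a ℕ.+ i ℕ.* W ℕ.^ k)

      slot-cost : (m ℕ.^ suc k) · q ≤ prefixCost (length slot) (P ∘ suc)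
      slot-cost with travels⊎dropServer-serves ψ (P ∘ suc) j slot serves
      ... | inj₁ (y , y∈slot , travel) = begin
        (m ℕ.^ suc k) · q                ≤⟨ spread _ _ _ (slot+gap≤top {k} i<m (proj₂ (All.lookup slot-range y∈slot))) ⟩
        ∣ ψ (a ℕ.+ W ℕ.^ suc k) - ψ y ∣  ≡⟨ cong (λ p → ∣ p - ψ y ∣) P₁j≡top ⟨
        ∣ P 1 j - ψ y ∣                  ≤⟨ travel ⟩
        prefixCost (length slot) (P ∘ suc) ∎
        where open ≤-Reasoning
      ... | inj₂ others-serve =
        ≤-trans (hardSeq-cost k _ _ others-serve) (prefixCost-dropServer (length slot) j (P ∘ suc))

    phases-cost : ∀ is → All (ℕ._< m) is → (P : Schedule (suc k)) → Serves ψ P (concatMap (phase k a) is) →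
                  (length is ℕ.* m ℕ.^ suc k) · q ≤ prefixCost (length (concatMap (phase k a) is)) P
    phases-cost [] [] P _ = ≤-refl
    phases-cost (i ∷ is) (i<m ∷ is<m) P serves with Serves-++⁻ ψ P (phase k a i) serves
    ... | serves-phase , serves-rest = begin
      (m ℕ.^ suc k ℕ.+ length is ℕ.* m ℕ.^ suc k) · q
        ≡⟨ ×-homo-+ q (m ℕ.^ suc k) _ ⟩
      (m ℕ.^ suc k) · q + (length is ℕ.* m ℕ.^ suc k) · q
        ≤⟨ +-mono-≤ (phase-cost i<m P serves-phase) (phases-cost is is<m _ serves-rest) ⟩
      prefixCost |phase| P + prefixCost |rest| (P ∘ (|phase| ℕ.+_))
        ≡⟨ prefixCost-+ |phase| |rest| P ⟨
      prefixCost (|phase| ℕ.+ |rest|) P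
        ≡⟨ cong (λ L → prefixCost L P) (Listₚ.length-++ (phase k a i)) ⟨
      prefixCost (length (phase k a i ++ concatMap (phase k a) is)) P ∎
      where
      open ≤-Reasoning

      |phase| |rest| : ℕ
      |phase| = length (phase k a i)
      |rest| = length (concatMap (phase k a) is)

Serves-lookupOr : ∀ {k} ψ d xs (P : Schedule k) →
  (∀ {t} → t ℕ.< length xs → ∃ λ j → P (suc t) j ≡ ψ (lookupOr d xs t)) → Serves ψ P xs
Serves-lookupOr ψ d [] P served = tt
Serves-lookupOr ψ d (x ∷ xs) P served = served (s≤s z≤n) , Serves-lookupOr ψ d xs (P ∘ suc) (served ∘ s≤s)

clamp : ∀ {n} → ℕ → Fin (suc n)
clamp {zero} _ = Fin.zero
clamp {suc n} zero = Fin.zero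
clamp {suc n} (suc t) = Fin.suc (clamp t)

clamp-toℕ : ∀ {n} (i : Fin (suc n)) → clamp (toℕ i) ≡ i
clamp-toℕ {zero} Fin.zero = refl
clamp-toℕ {suc n} Fin.zero = refl
clamp-toℕ {suc n} (Fin.suc i) = cong Fin.suc (clamp-toℕ i)

clamp-suc-toℕ : ∀ {n} (i : Fin n) → clamp (suc (toℕ i)) ≡ Fin.suc i
clamp-suc-toℕ {suc n} i = cong Fin.suc (clamp-toℕ i)

clamp-toℕ-inject₁ : ∀ {n} (i : Fin n) → clamp (toℕ i) ≡ Fin.inject₁ i
clamp-toℕ-inject₁ i = trans (cong clamp (sym (Finₚ.toℕ-inject₁ i))) (clamp-toℕ (Fin.inject₁ i))

module _ {n k : ℕ} {X : Seq n} (s : Solution n k X) where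
  open Solution s

  schedule : Schedule k
  schedule t = pos (clamp t)

  cost≡prefixCost : cost s ≡ prefixCost n schedule
  cost≡prefixCost = trans (sumFin-cong step≡) (sym (prefixCost≡sumFin n schedule))
    where
    step≡ : ∀ i → sumFin (λ j → ∣ pos (Fin.suc i) j - pos (Fin.inject₁ i) j ∣)
                ≡ sumFin (λ j → ∣ schedule (suc (toℕ i)) j - schedule (toℕ i) j ∣)
    step≡ i = cong₂ (λ a b → sumFin λ j → ∣ pos a j - pos b j ∣) (sym (clamp-suc-toℕ i)) (sym (clamp-toℕ-inject₁ i))

  schedule-serves : ∀ i → ∃ λ j → schedule (suc (toℕ i)) j ≡ X i
  schedule-serves i with serves i
  ... | j , posᵢj≡Xi = j , trans (cong (λ c → pos c j) (clamp-suc-toℕ i)) posᵢj≡Xi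

first-request≤cost : ∀ {n k X} (s : Solution (suc n) k X) → ∣ X Fin.zero - 0ℚ ∣ ≤ cost s
first-request≤cost {n} {X = X} s with schedule-serves s Fin.zero
... | j , P₁j≡X₀ = begin
  ∣ X Fin.zero - 0ℚ ∣                       ≡⟨ cong₂ (λ a b → ∣ a - b ∣) P₁j≡X₀ (Solution.start s j) ⟨
  ∣ schedule s 1 j - schedule s 0 j ∣       ≤⟨ term≤sumFin (λ i → 0≤∣p∣ (schedule s 1 i - schedule s 0 i)) j ⟩
  stepCost (schedule s)                     ≤⟨ p≤p+q (prefixCost-nonNeg n (schedule s ∘ suc)) ⟩
  prefixCost (suc n) (schedule s)           ≡⟨ cost≡prefixCost s ⟨
  cost s                                    ∎
  where open ≤-Reasoning

solution-serves : ∀ {n k} ψ d xs → length xs ℕ.≤ n → (s : Solution n k (λ i → ψ (lookupOr d xs (toℕ i)))) →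
  Serves ψ (schedule s) xs
solution-serves ψ d xs |xs|≤n s = Serves-lookupOr ψ d xs (schedule s) λ t<|xs| →
  subst (λ t → ∃ λ j → schedule s (suc t) j ≡ ψ (lookupOr d xs t)) (Finₚ.toℕ-fromℕ< _)
    (schedule-serves s (Fin.fromℕ< (ℕₚ.<-≤-trans t<|xs| |xs|≤n)))

record HardInput (σ : Pattern) (n k R : ℕ) : Set where
  field
    requests : Seq n
    inUnit   : ∀ i → InUnit (requests i)
    avoids   : Avoids requests (pattern→seq σ)
    costly   : ∀ (s : Solution n k requests) → fromℕ R ≤ fromℕ (pow4 k) * cost s

  bound : n ℕ.≤ 2 ℕ.^ k ℕ.* R ℕ.^ k →
    Σ (Seq n) λ X → (∀ i → InUnit (X i)) × Avoids X (pattern→seq σ) ×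
      (∀ (s : Solution n k X) → pow ½ k * fromℕ n ≤ pow (fromℕ (pow4 k) * cost s) k)
  bound n≤2^kR^k = requests , inUnit , avoids , λ s → half-pow-bound {n} {k} {R} n≤2^kR^k (costly s)

constant-avoids : ∀ {n m} c {Y : Seq m} i j → Y i < Y j → Avoids (λ (_ : Fin n) → c) Y
constant-avoids c i j Yi<Yj (_ , _ , iso) = <-irrefl refl (Equivalence.from (iso i j) Yi<Yj)

pattern-ascent : ∀ σ → Σ (Fin 3) λ i → Σ (Fin 3) λ j → pattern→seq σ i < pattern→seq σ j
pattern-ascent p132 = # 0 , # 1 , from-yes (fromℕ 1 <? fromℕ 3)
pattern-ascent p213 = # 1 , # 2 , from-yes (fromℕ 1 <? fromℕ 3)
pattern-ascent p231 = # 0 , # 1 , from-yes (fromℕ 2 <? fromℕ 3)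
pattern-ascent p312 = # 1 , # 2 , from-yes (fromℕ 1 <? fromℕ 2)

constantInput : ∀ σ n k → HardInput σ (suc n) k 1
constantInput σ n k = record
  { requests = λ _ → 1ℚ
  ; inUnit   = λ _ → from-yes (0ℚ ≤? 1ℚ) , ≤-refl
  ; avoids   = let (i , j , σi<σj) = pattern-ascent σ in constant-avoids 1ℚ i j σi<σj
  ; costly   = λ s → *-mono-≤-nonNeg (from-yes (0ℚ ≤? 1ℚ)) (fromℕ-mono-≤ (ℕₚ.m^n>0 4 k))
                                     (from-yes (0ℚ ≤? 1ℚ)) (first-request≤cost s)
  }

monotone⇒reflects-< : ∀ {ψ : ℕ → ℚ} → (∀ {u v} → u ℕ.≤ v → ψ u ≤ ψ v) →
  ∀ {u v} → ψ u < ψ v → u ℕ.< v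
monotone⇒reflects-< {ψ} mono {u} {v} ψu<ψv with u ℕ.<? v
... | yes u<v = u<v
... | no u≮v = contradiction (<-≤-trans ψu<ψv (mono (ℕₚ.≮⇒≥ u≮v))) (<-irrefl refl)

antitone⇒reverses-< : ∀ {ψ : ℕ → ℚ} → (∀ {u v} → u ℕ.≤ v → ψ v ≤ ψ u) →
  ∀ {u v} → ψ u < ψ v → v ℕ.< u
antitone⇒reverses-< {ψ} anti {u} {v} ψu<ψv with v ℕ.<? u
... | yes v<u = v<u
... | no v≮u = contradiction (<-≤-trans ψu<ψv (anti (ℕₚ.≮⇒≥ v≮u))) (<-irrefl refl)

1-p-inUnit : ∀ {p} → InUnit p → InUnit (1ℚ - p)
1-p-inUnit (0≤p , p≤1) = +-monoʳ-≤ 1ℚ (neg-antimono-≤ p≤1) , +-monoʳ-≤ 1ℚ (neg-antimono-≤ 0≤p)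

module _ {n : ℕ} (ψ : ℕ → ℚ) (g : ℕ → ℕ) where
  private
    X : Seq n
    X i = ψ (g (toℕ i))

  occurs-231 : (∀ {u v} → ψ u < ψ v → u ℕ.< v) → Contains X (digits 2 3 1) → Occurs Is231 g
  occurs-231 reflects (f , increasing , iso) = _ , _ , _ ,
    increasing (# 0) (# 1) (s≤s z≤n) , increasing (# 1) (# 2) (s≤s (s≤s z≤n)) ,
    reflects (Equivalence.from (iso (# 2) (# 0)) (from-yes (fromℕ 1 <? fromℕ 2))) ,
    reflects (Equivalence.from (iso (# 0) (# 1)) (from-yes (fromℕ 2 <? fromℕ 3)))

  occurs-132 : (∀ {u v} → ψ u < ψ v → u ℕ.< v) → Contains X (digits 1 3 2) → Occurs Is132 g
  occurs-132 reflects (f , increasing , iso) = _ , _ , _ ,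
    increasing (# 0) (# 1) (s≤s z≤n) , increasing (# 1) (# 2) (s≤s (s≤s z≤n)) ,
    reflects (Equivalence.from (iso (# 0) (# 2)) (from-yes (fromℕ 1 <? fromℕ 2))) ,
    reflects (Equivalence.from (iso (# 2) (# 1)) (from-yes (fromℕ 2 <? fromℕ 3)))

  occurs-213 : (∀ {u v} → ψ u < ψ v → v ℕ.< u) → Contains X (digits 2 1 3) → Occurs Is231 g
  occurs-213 reverses (f , increasing , iso) = _ , _ , _ ,
    increasing (# 0) (# 1) (s≤s z≤n) , increasing (# 1) (# 2) (s≤s (s≤s z≤n)) ,
    reverses (Equivalence.from (iso (# 0) (# 2)) (from-yes (fromℕ 2 <? fromℕ 3))) ,
    reverses (Equivalence.from (iso (# 1) (# 0)) (from-yes (fromℕ 1 <? fromℕ 2)))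

  occurs-312 : (∀ {u v} → ψ u < ψ v → v ℕ.< u) → Contains X (digits 3 1 2) → Occurs Is132 g
  occurs-312 reverses (f , increasing , iso) = _ , _ , _ ,
    increasing (# 0) (# 1) (s≤s z≤n) , increasing (# 1) (# 2) (s≤s (s≤s z≤n)) ,
    reverses (Equivalence.from (iso (# 2) (# 0)) (from-yes (fromℕ 2 <? fromℕ 3))) ,
    reverses (Equivalence.from (iso (# 1) (# 2)) (from-yes (fromℕ 1 <? fromℕ 2)))

module GridInput (n k M : ℕ) .{{_ : ℕ.NonZero M}} (N≤n : (2 ℕ.* M) ℕ.^ k ℕ.≤ n) where
  N : ℕ
  N = (2 ℕ.* M) ℕ.^ k

  instance
    N≢0 : ℕ.NonZero N
    N≢0 = ℕₚ.m^n≢0 (2 ℕ.* M) k {{ℕₚ.m*n≢0 2 M}}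

    fromℕN-positive : ℚ.Positive (fromℕ N)
    fromℕN-positive = fromℕ-positive N

    fromℕN-nonZero : ℚ.NonZero (fromℕ N)
    fromℕN-nonZero = pos⇒nonZero (fromℕ N)

  q : ℚ
  q = 1/ fromℕ N

  q≥0 : 0ℚ ≤ q
  q≥0 = <⇒≤ (positive⁻¹ q {{1/pos⇒pos (fromℕ N)}})

  N·q≡1 : N · q ≡ 1ℚ
  N·q≡1 = trans (sym (fromℕ*p≡·p N q)) (*-inverseʳ (fromℕ N))

  ψ⁺ ψ⁻ : ℕ → ℚ
  ψ⁺ g = g · q
  ψ⁻ g = 1ℚ - g · q

  ψ⁺-inUnit : ∀ {g} → g ℕ.≤ N → InUnit (ψ⁺ g)
  ψ⁺-inUnit {g} g≤N = ·-nonNeg q≥0 g , subst (g · q ≤_) N·q≡1 (·-monoˡ-≤ q≥0 g≤N)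

  ψ⁻-inUnit : ∀ {g} → g ℕ.≤ N → InUnit (ψ⁻ g)
  ψ⁻-inUnit = 1-p-inUnit ∘ ψ⁺-inUnit

  ψ⁺-spread : Spread q ψ⁺
  ψ⁺-spread u v e v+e≤u = ≤-trans (·-gap q≥0 {u} {v} {e} v+e≤u) (p≤∣p∣ (ψ⁺ u - ψ⁺ v))

  ψ⁻-spread : Spread q ψ⁻
  ψ⁻-spread u v e v+e≤u = subst (e · q ≤_) ∣ψ⁺-ψ⁺∣≡∣ψ⁻-ψ⁻∣ (ψ⁺-spread u v e v+e≤u)
    where
    ∣ψ⁺-ψ⁺∣≡∣ψ⁻-ψ⁻∣ : ∣ ψ⁺ u - ψ⁺ v ∣ ≡ ∣ ψ⁻ u - ψ⁻ v ∣
    ∣ψ⁺-ψ⁺∣≡∣ψ⁻-ψ⁻∣ = trans (∣p-q∣≡∣q-p∣ (ψ⁺ u) (ψ⁺ v))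
      (cong ∣_∣ (solve 2 (λ a b → b :- a := (con 1ℚ :- a) :- (con 1ℚ :- b)) refl (ψ⁺ u) (ψ⁺ v)))

  ψ⁺-reflects-< : ∀ {u v} → ψ⁺ u < ψ⁺ v → u ℕ.< v
  ψ⁺-reflects-< = monotone⇒reflects-< (·-monoˡ-≤ q≥0)

  ψ⁻-reverses-< : ∀ {u v} → ψ⁻ u < ψ⁻ v → v ℕ.< u
  ψ⁻-reverses-< = antitone⇒reverses-< λ u≤v → +-monoʳ-≤ 1ℚ (neg-antimono-≤ (·-monoˡ-≤ q≥0 u≤v))

  scaled-cost : ∀ {c} → (M ℕ.^ suc k) · q ≤ c → fromℕ (2 ℕ.^ k ℕ.* M) ≤ fromℕ (pow4 k) * c
  scaled-cost {c} lower = begin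
    fromℕ 2^kM                          ≡⟨ *-identityʳ (fromℕ 2^kM) ⟨
    fromℕ 2^kM * 1ℚ                     ≡⟨ cong (fromℕ 2^kM *_) N·q≡1 ⟨
    fromℕ 2^kM * N · q                  ≡⟨ trans (fromℕ*p≡·p 2^kM (N · q)) (×-assocˡ q 2^kM N) ⟩
    (2^kM ℕ.* N) · q                    ≡⟨ cong (_· q) (2^kM·[2M]^k≡4^k·M^[1+k] M k) ⟩
    (pow4 k ℕ.* M ℕ.^ suc k) · q        ≡⟨ trans (fromℕ*p≡·p (pow4 k) _) (×-assocˡ q (pow4 k) _) ⟨
    fromℕ (pow4 k) * (M ℕ.^ suc k) · q  ≤⟨ *-monoˡ-≤-nonNeg (fromℕ (pow4 k)) {{4^k≥0}} lower ⟩
    fromℕ (pow4 k) * c                  ∎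
    where
    open ≤-Reasoning

    2^kM : ℕ
    2^kM = 2 ℕ.^ k ℕ.* M

    4^k≥0 : ℚ.NonNegative (fromℕ (pow4 k))
    4^k≥0 = ℚ.nonNegative (fromℕ-nonNeg (pow4 k))

  gridInput : ∀ σ {R} offsets (offsets<M : All (ℕ._< M) offsets) → length offsets ≡ M →
    Avoiding R (Grid.hardSeq M offsets offsets<M k 0) → (∀ {x y} → x ℕ.≤ N → y ℕ.≤ N → ¬ R x y N) →
    (ψ : ℕ → ℚ) → (∀ {g} → g ℕ.≤ N → InUnit (ψ g)) → Spread q ψ →
    (∀ g → Contains (λ (i : Fin n) → ψ (g (toℕ i))) (pattern→seq σ) → Occurs R g) →
    HardInput σ n k (2 ℕ.^ k ℕ.* M)
  -- Past the end of hardSeq the requests repeat the top point N, which completes no R-triple.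
  gridInput σ offsets offsets<M |offsets|≡M avoiding top-free ψ inUnit spread occurs = record
    { requests = λ i → ψ (lookupOr N G (toℕ i))
    ; inUnit   = λ i → inUnit (All-lookupOr G ℕₚ.≤-refl G≤N (toℕ i))
    ; avoids   = avoiding⇒¬Occurs top-free G≤N avoiding ∘ occurs (lookupOr N G)
    ; costly   = λ s → scaled-cost (begin
        (M ℕ.^ suc k) · q                   ≤⟨ hardSeq-cost k 0 (schedule s) (solution-serves ψ N G |G|≤n s) ⟩
        prefixCost (length G) (schedule s)  ≤⟨ prefixCost-mono (schedule s) |G|≤n ⟩
        prefixCost n (schedule s)           ≡⟨ cost≡prefixCost s ⟨
        cost s                              ∎)
    }
    where
    open Grid M offsets offsets<M
    open CostBound M offsets offsets<M |offsets|≡M q≥0 ψ spread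
    open ≤-Reasoning

    G : List ℕ
    G = hardSeq k 0

    G≤N : All (ℕ._≤ N) G
    G≤N = All.map proj₂ (hardSeq-range k 0)

    |G|≤n : length G ℕ.≤ n
    |G|≤n = ℕₚ.≤-trans (length-hardSeq (ℕₚ.≤-reflexive |offsets|≡M) k 0) N≤n

  downFrom<M : All (ℕ._< M) (downFrom M)
  downFrom<M = Allₚ.applyDownFrom⁺₁ id M id

  module Ascending = Grid M (upTo M) (Allₚ.all-upTo M)
  module Descending = Grid M (downFrom M) downFrom<M

  ascending-avoids-231 : Avoiding Is231 (Ascending.hardSeq k 0)
  ascending-avoids-231 = Ascending.hardSeq-avoiding proj₂
    (AllPairsₚ.applyUpTo⁺₁ id M λ i<j _ → i<j) (λ {k} {a} → Ascending.separated231 {k} {a}) k 0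

  descending-avoids-132 : Avoiding Is132 (Descending.hardSeq k 0)
  descending-avoids-132 = Descending.hardSeq-avoiding (λ (x<z , z<y) → ℕₚ.<-trans x<z z<y)
    (AllPairsₚ.applyDownFrom⁺₁ id M λ j<i _ → j<i) (λ {k} {a} → Descending.separated132 {k} {a}) k 0

  top-free-231 : ∀ {x y} → x ℕ.≤ N → y ℕ.≤ N → ¬ Is231 x y N
  top-free-231 x≤N _ (N<x , _) = ℕₚ.<⇒≱ N<x x≤N

  top-free-132 : ∀ {x y} → x ℕ.≤ N → y ℕ.≤ N → ¬ Is132 x y N
  top-free-132 _ y≤N (_ , N<y) = ℕₚ.<⇒≱ N<y y≤N

  input : ∀ σ → HardInput σ n k (2 ℕ.^ k ℕ.* M)
  input p231 = gridInput p231 (upTo M) (Allₚ.all-upTo M) (Listₚ.length-upTo M) ascending-avoids-231 top-free-231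
    ψ⁺ ψ⁺-inUnit ψ⁺-spread λ g → occurs-231 ψ⁺ g ψ⁺-reflects-<
  input p213 = gridInput p213 (upTo M) (Allₚ.all-upTo M) (Listₚ.length-upTo M) ascending-avoids-231 top-free-231
    ψ⁻ ψ⁻-inUnit ψ⁻-spread λ g → occurs-213 ψ⁻ g ψ⁻-reverses-<
  input p132 = gridInput p132 (downFrom M) downFrom<M (Listₚ.length-downFrom M) descending-avoids-132 top-free-132
    ψ⁺ ψ⁺-inUnit ψ⁺-spread λ g → occurs-132 ψ⁺ g ψ⁺-reflects-<
  input p312 = gridInput p312 (downFrom M) downFrom<M (Listₚ.length-downFrom M) descending-avoids-132 top-free-132
    ψ⁻ ψ⁻-inUnit ψ⁻-spread λ g → occurs-312 ψ⁻ g ψ⁻-reverses-<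

exists-hardInput : ∀ σ n k → n ≥ 1 → k ≥ 1 → ∃ λ R → n ℕ.≤ 2 ℕ.^ k ℕ.* R ℕ.^ k × HardInput σ n k R
exists-hardInput σ (suc n) (suc k) _ _ with bracket (λ M → (2 ℕ.* M) ℕ.^ suc k) (2 ℕ.+ n) z≤n n<[4+2n]^[1+k]
  where
  n<[4+2n]^[1+k] : suc n ℕ.< (2 ℕ.* (2 ℕ.+ n)) ℕ.^ suc k
  n<[4+2n]^[1+k] = ℕₚ.≤-trans (ℕₚ.m≤m+n (2 ℕ.+ n) _) (m≤m^[1+k] (2 ℕ.* (2 ℕ.+ n)) k)
... | zero , _ , n<2^[1+k] =
  1 , ℕₚ.≤-trans (ℕₚ.<⇒≤ n<2^[1+k]) (m≤m*1^k (2 ℕ.^ suc k) (suc k)) , constantInput σ n (suc k)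
... | suc M , N≤n , n<N′ = 2 ℕ.^ suc k ℕ.* suc M ,
  ℕₚ.≤-trans (ℕₚ.<⇒≤ n<N′) ([2+2M]^[1+k]≤2^[1+k]·[2^[1+k]·M]^[1+k] (suc M) k) ,
  GridInput.input (suc n) (suc k) (suc M) N≤n σ

theorem3p13 : Σ ℚ λ c → (0ℚ < c) ×
    (∀ (σ : Pattern) (n k : ℕ) → n ≥ 1 → k ≥ 1 →
      Σ (Seq n) λ X → (∀ i → InUnit (X i)) × Avoids X (pattern→seq σ) ×
        (∀ (s : Solution n k X) →
          pow c k * fromℕ n ≤ pow (fromℕ (pow4 k) * cost s) k))
theorem3p13 = ½ , from-yes (0ℚ <? ½) , λ σ n k n≥1 k≥1 →
  let (R , n≤2^kR^k , input) = exists-hardInput σ n k n≥1 k≥1 in HardInput.bound input n≤2^kR^k
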